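{- Let $n>1$, $\textsf{AP}=\{p\}$, let $M_n$ be a tree structure as described in the context, let $\textsf{Agts}$ be a finite set of agents containing the agent $a$, and let $\varphi_p$ be the KLTL sentence $\forall\textsf{X}\textsf{F}\textsf{K}_a\neg p$. Then for every $p$-blind observation map $\textit{Obs}:\textsf{Agts}\to2^{\{p\}}$, $(M_n,\textit{Obs})\models\varphi_p$.
   Context: KCTL$^*$ semantics on an extended Kripke structure $(K,\textit{Obs})$ ($K$ with total transition relation and valuation $V$, $\textit{Obs}:\textsf{Agts}\to2^{\textsf{AP}}$), at initial path $\pi$ and position $i$: atoms, Booleans, $\textsf{X}$, $\textsf{U}$ standard; $\exists\varphi$ holds iff some initial $\pi'$ with $\pi'[0,i]=\pi[0,i]$ satisfies $\varphi$ at $i$; $\forall=\neg\exists\neg$; $\textsf{F}\varphi=\top\textsf{U}\varphi$; $\textsf{K}_a\varphi$ holds iff every initial $\pi'$ with $V(\pi'(j))\cap\textit{Obs}(a)=V(\pi(j))\cap\textit{Obs}(a)$ for all $j\le i$ satisfies $\varphi$ at $i$. $(K,\textit{Obs})\models\varphi$ iff $\pi,0\models\varphi$ for some initial $\pi$. An observation map is $p$-blind if $p\notin\textit{Obs}(b)$ for every agent $b$. Tree structures: nodes form a prefix-closed subset of $\mathbb{N}^*$, root $\varepsilon$ initial, edges only to children; regular = unwinding of a finite Kripke structure. An $n$-block is a word in $\{p\}\emptyset^*$ of length at least $n+2$. $\textit{join}(w_1,\ldots,w_k)$ (for words of common length) is the letterwise union; the dual $\widetilde w$ flips the presence of $p$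 at every position. $\langle w_1,\ldots,w_n\rangle$ (same length) satisfies the $n$-fractal requirement if for all $k\in[1,n]$, $\textit{join}(w_1,\ldots,w_k)=bl^k_1\cdots bl^k_{m_k}\cdot\{p\}$ with $n$-blocks $bl^k_i$, $m_1=n+4$, and for $k<n$, $w_{k+1}$ is obtained from $\textit{join}(w_1,\ldots,w_k)$ by replacing its last symbol with $\emptyset$ and each $n$-block $bl^k_i$ by a sequence of $n+4$ $n$-blocks preceded by a non-empty word in $\emptyset^*$ of length at least $n+2$. $K_n$ is any regular tree structure over $2^{\{p\}}$ such that for some $\ell_n>1$: the root has exactly $n+1$ distinct successors $\eta,\xi_1,\ldots,\xi_n$ with a unique initial path through each (denoted $\pi(\eta),\pi(\xi_k)$); there are words $w_0,\ldots,w_n$ of length $\ell_n$ with trace of $\pi(\eta)$ equal to $\emptyset w_0\{p\}^\omega$, trace of $\pi(\xi_k)$ equal to $\emptyset w_k\emptyset^\omega$, $\langle w_1,\ldots,w_n\rangle$ satisfying the $n$-fractal requirement and $w_0$ the dual of $\textit{join}(w_1,\ldots,w_n)$. A main position is one in $[1,\ell_n]$; $i_{\textit{alert}}$ is the third main position $i$ (in increasing order) at which $\pi(\xi_1)(i)$ has label $\{p\}$ in $K_n$. $M_n$ is obtained from $K_n$ by replacing the label $\{p\}$ of $\pi(\xi_1)$ at position $i_{\textit{alert}}$ with $\emptyset$. -}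

module Defs where

open import Data.Nat using (ℕ; zero; suc; _+_; _≤_; _<_; _<ᵇ_)
open import Data.Bool using (Bool; true; false; not; _∧_; _∨_; if_then_else_)
open import Data.List using (List; []; _∷_; _++_; [_]; length; replicate; concat; map; zipWith)
open import Data.List.Properties using (≡-dec)
open import Data.List.Relation.Unary.All using (All)
open import Data.List.Relation.Binary.Pointwise using (Pointwise)
open import Data.Fin using (Fin)
open import Data.Product using (Σ; _×_; _,_; proj₁; proj₂)
open import Data.Sum using (_⊎_)
open import Relation.Nullary using (¬_; yes; no)
open import Relation.Binary.PropositionalEquality using (_≡_)
import Data.Nat as N

-- Kripke structures over AP = {p}.  A label V(s) ⊆ {p} is encoded as a
-- Bool: V s ≡ true iff p ∈ V(s).

record Kripke : Set₁ where
  field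
    State : Set
    Init  : State → Set
    R     : State → State → Set
    total : ∀ s → Σ State (R s)
    V     : State → Bool

module _ (K : Kripke) where
  open Kripke K

  Path : Set
  Path = Σ (ℕ → State) (λ π → ∀ i → R (π i) (π (suc i)))

  Initial : Path → Set
  Initial π = Init (proj₁ π 0)

data Formula (Agts : Set) : Set where
  prop  : Formula Agts
  ¬'_   : Formula Agts → Formula Agts
  _∧'_  : Formula Agts → Formula Agts → Formula Agts
  X     : Formula Agts → Formula Agts
  _U_   : Formula Agts → Formula Agts → Formula Agts
  E     : Formula Agts → Formula Agts
  Kn    : Agts → Formula Agts → Formula Agts

module _ {Agts : Set} where
  ⊤' : Formula Agts
  ⊤' = ¬' (prop ∧' (¬' prop))

  A : Formula Agts → Formula Agts
  A φ = ¬' (E (¬' φ))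

  F : Formula Agts → Formula Agts
  F φ = ⊤' U φ

-- semantics  (K, Obs), π, i ⊨ φ ; Obs a = true iff p ∈ Obs(a)
sat : (K : Kripke) {Agts : Set} (Obs : Agts → Bool) →
      Path K → ℕ → Formula Agts → Set
sat K Obs π i prop = Kripke.V K (proj₁ π i) ≡ true
sat K Obs π i (¬' φ) = ¬ sat K Obs π i φ
sat K Obs π i (φ ∧' ψ) = sat K Obs π i φ × sat K Obs π i ψ
sat K Obs π i (X φ) = sat K Obs π (suc i) φ
sat K Obs π i (φ U ψ) =
  Σ ℕ λ k → i ≤ k × sat K Obs π k ψ × (∀ j → i ≤ j → j < k → sat K Obs π j φ)
sat K Obs π i (E φ) =
  Σ (Path K) λ π' → Initial K π' × (∀ j → j ≤ i → proj₁ π' j ≡ proj₁ π j)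
                   × sat K Obs π' i φ
sat K Obs π i (Kn a φ) =
  (π' : Path K) → Initial K π' →
  (∀ j → j ≤ i → (Kripke.V K (proj₁ π' j) ∧ Obs a) ≡ (Kripke.V K (proj₁ π j) ∧ Obs a)) →
  sat K Obs π' i φ

Models : (K : Kripke) {Agts : Set} (Obs : Agts → Bool) → Formula Agts → Set
Models K Obs φ = Σ (Path K) λ π → Initial K π × sat K Obs π 0 φ

pBlind : {Agts : Set} → (Agts → Bool) → Set
pBlind Obs = ∀ b → Obs b ≡ false

φp : {Agts : Set} → Agts → Formula Agts
φp a = A (X (F (Kn a (¬' prop))))

record TreeStructure : Set₁ where
  field
    Node          : List ℕ → Set
    Node-prop     : ∀ {x} (u v : Node x) → u ≡ v     -- Node is a subset
    prefix-closed : ∀ x c → Node (x ++ [ c ]) → Node x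
    root          : Node []
    R             : Σ (List ℕ) Node → Σ (List ℕ) Node → Set
    R-child       : ∀ s t → R s t → Σ ℕ λ c → proj₁ t ≡ proj₁ s ++ [ c ]
    total         : ∀ s → Σ (Σ (List ℕ) Node) (R s)
    V             : Σ (List ℕ) Node → Bool

TState : TreeStructure → Set
TState T = Σ (List ℕ) (TreeStructure.Node T)

rootS : (T : TreeStructure) → TState T
rootS T = [] , TreeStructure.root T

toKripke : TreeStructure → Kripke
toKripke T = record
  { State = TState T
  ; Init  = λ s → proj₁ s ≡ []
  ; R     = TreeStructure.R T
  ; total = TreeStructure.total T
  ; V     = TreeStructure.V T
  }

-- Regular: T is (isomorphic to) the unwinding of a finite Kripke structure
-- (states Fin m, from initial state s0): h maps nodes to states, preserves
-- labels, maps the root to s0, and maps the children of each node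
-- bijectively onto the successors of its image; every child of a node is
-- an edge target.
record Unwinding (T : TreeStructure) : Set₁ where
  open TreeStructure T
  field
    m      : ℕ
    R'     : Fin m → Fin m → Set
    total' : ∀ u → Σ (Fin m) (R' u)
    V'     : Fin m → Bool
    s0     : Fin m
    h      : TState T → Fin m
    h-root : h (rootS T) ≡ s0
    h-V    : ∀ s → V s ≡ V' (h s)
    h-R    : ∀ s t → R s t → R' (h s) (h t)
    h-inj  : ∀ s t t' → R s t → R s t' → h t ≡ h t' → t ≡ t'
    h-surj : ∀ s u → R' (h s) u → Σ (TState T) λ t → R s t × h t ≡ u
    edges  : ∀ x c (nd : Node (x ++ [ c ])) →
             R (x , prefix-closed x c nd) (x ++ [ c ] , nd)

Regular : TreeStructure → Set₁
Regular T = Unwinding T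

IsBlock : ℕ → List Bool → Set
IsBlock n bl = Σ ℕ λ k → n + 1 ≤ k × bl ≡ true ∷ replicate k false

joinTo : ℕ → (ℕ → List Bool) → ℕ → List Bool
joinTo ℓ ws zero = replicate ℓ false
joinTo ℓ ws (suc k) = zipWith _∨_ (joinTo ℓ ws k) (ws (suc k))

dual : List Bool → List Bool
dual = map not

Replaces : ℕ → List Bool → List Bool → Set
Replaces n bl r =
  length r ≡ length bl ×
  Σ ℕ λ z → Σ (List (List Bool)) λ bs →
    n + 2 ≤ z × length bs ≡ n + 4 × All (IsBlock n) bs ×
    r ≡ replicate z false ++ concat bs

-- ⟨w_1,…,w_n⟩ (given as ws 1, …, ws n, each of length ℓ) satisfies the
-- n-fractal requirement; bl k is the block decomposition of join(w_1..w_k)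
Fractal : ℕ → ℕ → (ℕ → List Bool) → Set
Fractal n ℓ ws =
  Σ (ℕ → List (List Bool)) λ bl →
    (∀ k → 1 ≤ k → k ≤ n →
       All (IsBlock n) (bl k) × joinTo ℓ ws k ≡ concat (bl k) ++ [ true ]) ×
    length (bl 1) ≡ n + 4 ×
    (∀ k → 1 ≤ k → k < n →
       Σ (List (List Bool)) λ reps →
         Pointwise (Replaces n) (bl k) reps × ws (suc k) ≡ concat reps ++ [ false ])

-- the infinite trace ∅ · w · d^ω
wordAt : List Bool → ℕ → Bool
wordAt [] _ = false
wordAt (b ∷ w) zero = b
wordAt (b ∷ w) (suc j) = wordAt w j

embed : List Bool → Bool → ℕ → Bool
embed w d zero = false
embed w d (suc j) = if j <ᵇ length w then wordAt w j else d

-- The data witnessing that T is a K_n (regularity separately)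

record KnData (n : ℕ) (T : TreeStructure) : Set where
  open TreeStructure T using (R; V)
  field
    ℓ     : ℕ
    1<ℓ   : 1 < ℓ
    η     : TState T
    ξ     : ℕ → TState T          -- ξ k for k ∈ [1,n]
    η-succ : R (rootS T) η
    ξ-succ : ∀ k → 1 ≤ k → k ≤ n → R (rootS T) (ξ k)
    η≢ξ    : ∀ k → 1 ≤ k → k ≤ n → ¬ (η ≡ ξ k)
    ξ-inj  : ∀ k k' → 1 ≤ k → k ≤ n → 1 ≤ k' → k' ≤ n → ξ k ≡ ξ k' → k ≡ k'
    succ-exhaust : ∀ s → R (rootS T) s →
                   s ≡ η ⊎ Σ ℕ λ k → 1 ≤ k × k ≤ n × s ≡ ξ k
    πη      : Path (toKripke T)
    πη-init : Initial (toKripke T) πη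
    πη-thr  : proj₁ πη 1 ≡ η
    πη-uniq : ∀ π' → Initial (toKripke T) π' → proj₁ π' 1 ≡ η →
              ∀ i → proj₁ π' i ≡ proj₁ πη i
    πξ      : ℕ → Path (toKripke T)
    πξ-init : ∀ k → 1 ≤ k → k ≤ n → Initial (toKripke T) (πξ k)
    πξ-thr  : ∀ k → 1 ≤ k → k ≤ n → proj₁ (πξ k) 1 ≡ ξ k
    πξ-uniq : ∀ k → 1 ≤ k → k ≤ n →
              ∀ π' → Initial (toKripke T) π' → proj₁ π' 1 ≡ ξ k →
              ∀ i → proj₁ π' i ≡ proj₁ (πξ k) i
    w0      : List Bool
    ws      : ℕ → List Bool
    len0    : length w0 ≡ ℓ
    lens    : ∀ k → 1 ≤ k → k ≤ n → length (ws k) ≡ ℓ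
    traceη  : ∀ i → V (proj₁ πη i) ≡ embed w0 true i
    traceξ  : ∀ k → 1 ≤ k → k ≤ n →
              ∀ i → V (proj₁ (πξ k) i) ≡ embed (ws k) false i
    fractal : Fractal n ℓ ws
    w0-dual : w0 ≡ dual (joinTo ℓ ws n)

-- number of positions j ∈ [1,i] with f j ≡ true
cnt : (ℕ → Bool) → ℕ → ℕ
cnt f zero = 0
cnt f (suc j) = cnt f j + (if f (suc j) then 1 else 0)

-- i is i_alert: the third main position (in [1,ℓ]) at which π(ξ_1) has label {p}
IsAlert : {n : ℕ} {T : TreeStructure} → KnData n T → ℕ → Set
IsAlert {n} {T} D i =
  Σ ℕ λ j → i ≡ suc j × suc j ≤ KnData.ℓ D × f (suc j) ≡ true × cnt f j ≡ 2
  where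
  f : ℕ → Bool
  f k = TreeStructure.V T (proj₁ (KnData.πξ D 1) k)

Mn : (n : ℕ) (T : TreeStructure) → KnData n T → ℕ → TreeStructure
Mn n T D i = record T { V = V' }
  where
  x : List ℕ
  x = proj₁ (proj₁ (KnData.πξ D 1) i)
  V' : TState T → Bool
  V' s with ≡-dec N._≟_ (proj₁ s) x
  ... | yes _ = false
  ... | no _ = TreeStructure.V T s

module Submission where

-- At the alert position i = j+1 the atom p is false on EVERY
-- initial path of M_n; then K_a ¬p holds at i whatever a observes, so every
-- path satisfies X F K_a ¬p (take F's witness to be i).
--   * On π(ξ_1) the node at i is relabelled ∅ in M_n.
--   * Since w_1 has p at j, so does join(w_1..w_k) for every k ≤ n; hence
--     w_0 = dual(join(w_1..w_n)) lacks p at j, i.e. π(η) lacks p at i.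
--   * For k < n, w_{k+1} arises from join(w_1..w_k) by replacing each
--     n-block {p}∅^m by a word that begins with ∅ and has the same length,
--     and the final {p} by ∅; so w_{k+1} lacks p wherever the join has it.
--   * Every initial path of a K_n is one of π(η), π(ξ_1), …, π(ξ_n).

open import Defs
open import Data.Nat using (ℕ; zero; suc; _≤_; _<_; _<ᵇ_; z≤n; s≤s)
open import Data.Nat.Properties using (suc-injective; m+n≤o⇒n≤o; <⇒≤; ≤-trans; ≤-refl; n≤1+n; <⇒<ᵇ)
open import Data.Fin using (Fin)
open import Data.Bool using (Bool; true; false; _∨_)
open import Data.Bool.Properties using (∨-zeroʳ)
open import Data.List using (List; []; _∷_; _++_; [_]; length; replicate; concat; zipWith)
open import Data.List.Properties using (length-replicate; ++-assoc; ≡-dec)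
open import Data.List.Relation.Unary.All using (All; []; _∷_)
open import Data.List.Relation.Binary.Pointwise using (Pointwise; []; _∷_)
open import Data.Product using (Σ; _×_; _,_; proj₁; proj₂)
open import Data.Sum using (_⊎_; inj₁; inj₂)
open import Relation.Nullary using (¬_; no)
open import Relation.Binary.PropositionalEquality using (_≡_; refl; sym; trans; cong; subst; _≢_; module ≡-Reasoning)
import Data.Nat as N

_Excludes-p-of_ : List Bool → List Bool → Set
v Excludes-p-of u = ∀ j → wordAt u j ≡ true → wordAt v j ≡ false

pad-excludes : ∀ {k r} u s → length u ≡ k → s Excludes-p-of r →
               (u ++ s) Excludes-p-of (replicate k false ++ r)
pad-excludes {zero}  []      s refl s∖r j       h = s∖r j h
pad-excludes {suc k} (c ∷ u) s |u|≡ s∖r (suc j) h = pad-excludes u s (suc-injective |u|≡) s∖r j h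

-- A replacement of an n-block starts with ∅ (its ∅-prefix has length
-- ≥ n+2) and has the block's length, so it lacks p wherever the block has p.
replacement-excludes : ∀ {n bl r r₁ r₂} → IsBlock n bl → Replaces n bl r →
                       r₂ Excludes-p-of r₁ → (r ++ r₂) Excludes-p-of (bl ++ r₁)
replacement-excludes {n} (_ , _ , refl) (_ , zero , _ , n+2≤0 , _) _ _ _
  with m+n≤o⇒n≤o n n+2≤0
... | ()
replacement-excludes (_ , _ , refl) (_ , suc z , _ , _ , _ , _ , refl) _ zero _ = refl
replacement-excludes {r₂ = r₂} (k , _ , refl) (|r|≡ , suc z , bs , _ , _ , _ , refl) r₂∖r₁ (suc j) h =
  pad-excludes (replicate z false ++ concat bs) r₂ (trans (suc-injective |r|≡) (length-replicate k)) r₂∖r₁ j h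

fractal-step-excludes : ∀ {n bls reps} → All (IsBlock n) bls →
  Pointwise (Replaces n) bls reps →
  (concat reps ++ [ false ]) Excludes-p-of (concat bls ++ [ true ])
fractal-step-excludes [] [] zero _ = refl
fractal-step-excludes {bls = bl ∷ bls} {r ∷ reps} (isB ∷ isBs) (rep ∷ reps-ok)
  rewrite ++-assoc bl (concat bls) [ true ] | ++-assoc r (concat reps) [ false ] =
  replacement-excludes isB rep (fractal-step-excludes isBs reps-ok)

∨-keeps-pˡ : ∀ u v j → wordAt u j ≡ true → j < length v →
             wordAt (zipWith _∨_ u v) j ≡ true
∨-keeps-pˡ (x ∷ u) (y ∷ v) zero    refl _       = refl
∨-keeps-pˡ (x ∷ u) (y ∷ v) (suc j) h    (s≤s j<) = ∨-keeps-pˡ u v j h j<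

∨-keeps-pʳ : ∀ u v j → wordAt v j ≡ true → j < length u →
             wordAt (zipWith _∨_ u v) j ≡ true
∨-keeps-pʳ (x ∷ u) (y ∷ v) zero    refl _       = ∨-zeroʳ x
∨-keeps-pʳ (x ∷ u) (y ∷ v) (suc j) h    (s≤s j<) = ∨-keeps-pʳ u v j h j<

dual-excludes : ∀ w → dual w Excludes-p-of w
dual-excludes (true  ∷ w) zero    refl = refl
dual-excludes (_     ∷ w) (suc j) h    = dual-excludes w j h

embed-main : ∀ w d {j} → j < length w → embed w d (suc j) ≡ wordAt w j
embed-main w d {j} j<|w| with j <ᵇ length w | <⇒<ᵇ j<|w|
... | true | _ = refl

module FractalColumn {n ℓ : ℕ} {ws : ℕ → List Bool}
  (lens : ∀ k → 1 ≤ k → k ≤ n → length (ws k) ≡ ℓ)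
  {j : ℕ} (j<ℓ : j < ℓ) (w₁-p : wordAt (ws 1) j ≡ true) where

  -- Joins only add p's, so each join(w_1..w_k) keeps the p of w_1 at j.
  join-has-p : ∀ k → 1 ≤ k → k ≤ n → wordAt (joinTo ℓ ws k) j ≡ true
  join-has-p (suc zero) _ _ =
    ∨-keeps-pʳ (replicate ℓ false) (ws 1) j w₁-p (subst (j <_) (sym (length-replicate ℓ)) j<ℓ)
  join-has-p (suc (suc k)) _ k+2≤n =
    ∨-keeps-pˡ (joinTo ℓ ws (suc k)) (ws (suc (suc k))) j
      (join-has-p (suc k) (s≤s z≤n) (≤-trans (n≤1+n _) k+2≤n))
      (subst (j <_) (sym (lens (suc (suc k)) (s≤s z≤n) k+2≤n)) j<ℓ)

  -- w_{k+1} is the block replacement of join(w_1..w_k), which has p at j.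
  later-lacks-p : Fractal n ℓ ws → ∀ k → 1 ≤ k → k < n → wordAt (ws (suc k)) j ≡ false
  later-lacks-p (_ , blocks , _ , step) k 1≤k k<n
    with blocks k 1≤k (<⇒≤ k<n) | step k 1≤k k<n
  ... | isBs , join≡ | reps , reps-ok , w≡ =
    subst (λ w → wordAt w j ≡ false) (sym w≡)
      (fractal-step-excludes isBs reps-ok j
        (subst (λ w → wordAt w j ≡ true) join≡ (join-has-p k 1≤k (<⇒≤ k<n))))

  -- This column gives π(η) the label ∅ at the main position j+1.
  dual-lacks-p : 1 ≤ n → wordAt (dual (joinTo ℓ ws n)) j ≡ false
  dual-lacks-p 1≤n = dual-excludes (joinTo ℓ ws n) j (join-has-p n 1≤n ≤-refl)

initial-is-root : (T : TreeStructure) (s : TState T) → proj₁ s ≡ [] → s ≡ rootS T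
initial-is-root T (.[] , nd) refl = cong ([] ,_) (TreeStructure.Node-prop T nd (TreeStructure.root T))

initial-path-cases : ∀ {n T} (D : KnData n T) (π : Path (toKripke T)) → Initial (toKripke T) π →
  (∀ i → proj₁ π i ≡ proj₁ (KnData.πη D) i) ⊎
  Σ ℕ λ k → 1 ≤ k × k ≤ n × (∀ i → proj₁ π i ≡ proj₁ (KnData.πξ D k) i)
initial-path-cases {T = T} D π init
  with KnData.succ-exhaust D (proj₁ π 1)
         (subst (λ s → TreeStructure.R T s (proj₁ π 1)) (initial-is-root T (proj₁ π 0) init) (proj₂ π 0))
... | inj₁ via-η = inj₁ (KnData.πη-uniq D π init via-η)
... | inj₂ (k , 1≤k , k≤n , via-ξ) = inj₂ (k , 1≤k , k≤n , KnData.πξ-uniq D k 1≤k k≤n π init via-ξ)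

Mn-label : ∀ {n T} (D : KnData n T) (i : ℕ) (s : TState T) →
  TreeStructure.V (Mn n T D i) s ≡ true →
  TreeStructure.V T s ≡ true × proj₁ s ≢ proj₁ (proj₁ (KnData.πξ D 1) i)
Mn-label D i s h with ≡-dec N._≟_ (proj₁ s) (proj₁ (proj₁ (KnData.πξ D 1) i))
... | no ≢x = h , ≢x

∅-not-p : ∀ {b} → b ≡ false → ¬ (b ≡ true)
∅-not-p refl ()

module AlertColumn {n T} (D : KnData n T) (1≤n : 1 ≤ n) {j : ℕ} (j<ℓ : j < KnData.ℓ D)
  (ξ₁-p : TreeStructure.V T (proj₁ (KnData.πξ D 1) (suc j)) ≡ true) where
  open KnData D
  open TreeStructure T using (V)

  w₁-p : wordAt (ws 1) j ≡ true
  w₁-p = begin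
    wordAt (ws 1) j                     ≡⟨ embed-main (ws 1) false (subst (j <_) (sym (lens 1 ≤-refl 1≤n)) j<ℓ) ⟨
    embed (ws 1) false (suc j)          ≡⟨ traceξ 1 ≤-refl 1≤n (suc j) ⟨
    V (proj₁ (πξ 1) (suc j))            ≡⟨ ξ₁-p ⟩
    true                                ∎
    where open ≡-Reasoning

  open FractalColumn {ws = ws} lens j<ℓ w₁-p

  η-lacks-p : V (proj₁ πη (suc j)) ≡ false
  η-lacks-p = begin
    V (proj₁ πη (suc j))                ≡⟨ traceη (suc j) ⟩
    embed w0 true (suc j)               ≡⟨ embed-main w0 true (subst (j <_) (sym len0) j<ℓ) ⟩
    wordAt w0 j                         ≡⟨ cong (λ w → wordAt w j) w0-dual ⟩
    wordAt (dual (joinTo ℓ ws n)) j     ≡⟨ dual-lacks-p 1≤n ⟩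
    false                               ∎
    where open ≡-Reasoning

  ξ-lacks-p : ∀ k → 1 ≤ k → k < n → V (proj₁ (πξ (suc k)) (suc j)) ≡ false
  ξ-lacks-p k 1≤k k<n = begin
    V (proj₁ (πξ (suc k)) (suc j))      ≡⟨ traceξ (suc k) (s≤s z≤n) k<n (suc j) ⟩
    embed (ws (suc k)) false (suc j)    ≡⟨ embed-main (ws (suc k)) false (subst (j <_) (sym (lens (suc k) (s≤s z≤n) k<n)) j<ℓ) ⟩
    wordAt (ws (suc k)) j               ≡⟨ later-lacks-p fractal k 1≤k k<n ⟩
    false                               ∎
    where open ≡-Reasoning

  Mn-lacks-p : ∀ (π : Path (toKripke T)) → Initial (toKripke T) π →
               ¬ (TreeStructure.V (Mn n T D (suc j)) (proj₁ π (suc j)) ≡ true)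
  Mn-lacks-p π init Mn-p with Mn-label D (suc j) (proj₁ π (suc j)) Mn-p | initial-path-cases D π init
  ... | K-p , _ | inj₁ on-η =
    ∅-not-p (trans (cong V (on-η (suc j))) η-lacks-p) K-p
  ... | _ , not-relabelled | inj₂ (suc zero , _ , _ , on-ξ₁) =
    not-relabelled (cong proj₁ (on-ξ₁ (suc j)))
  ... | K-p , _ | inj₂ (suc (suc k) , _ , k+2≤n , on-ξ) =
    ∅-not-p (trans (cong V (on-ξ (suc j))) (ξ-lacks-p (suc k) (s≤s z≤n) k+2≤n)) K-p

-- φ_p = ∀ X F K_a ¬p holds in any structure (with an initial path) in which
-- p is false at some common position i ≥ 1 on all initial paths: then
-- K_a ¬p holds at i on every path, whatever agent a observes.
φp-from-common-absence : (K : Kripke) {Agts : Set} (Obs : Agts → Bool) (a : Agts) →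
  (π₀ : Path K) → Initial K π₀ → (i : ℕ) → 1 ≤ i →
  (∀ π → Initial K π → ¬ (Kripke.V K (proj₁ π i) ≡ true)) →
  Models K Obs (φp a)
φp-from-common-absence K Obs a π₀ init₀ i 1≤i absent =
  π₀ , init₀ , λ (π , _ , _ , ¬XFK) → ¬XFK (i , 1≤i , knows π , λ k _ _ → ⊤'-holds π k)
  where
  knows : ∀ π → sat K Obs π i (Kn a (¬' prop))
  knows _ π' init' _ = absent π' init'
  ⊤'-holds : ∀ π k → sat K Obs π k ⊤'
  ⊤'-holds _ _ (p , ¬p) = ¬p p

proposition4 : (n : ℕ) → 1 < n → (T : TreeStructure) → Regular T →
    (D : KnData n T) → (i : ℕ) → IsAlert D i →
    (m : ℕ) (a : Fin m) (Obs : Fin m → Bool) → pBlind Obs →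
    Models (toKripke (Mn n T D i)) Obs (φp a)
proposition4 n 1<n T _ D .(suc j) (j , refl , j<ℓ , ξ₁-p , _) m a Obs _ =
  φp-from-common-absence (toKripke (Mn n T D (suc j))) Obs a
    (KnData.πη D) (KnData.πη-init D) (suc j) (s≤s z≤n)
    (AlertColumn.Mn-lacks-p D (<⇒≤ 1<n) j<ℓ ξ₁-p)
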